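{- Let $\pi$ be an SCC-path of an NFA $\mathcal{A}$ and let $\mu$ be a positional word. If $\mu$ contains a strongly blocking sequence for $\pi$, then $\mu\notin L(\pi)$.
   Context: $\mathcal{A}=(Q,\Sigma,\delta,q_0,F)$ NFA. SCC = maximal set of mutually reachable states; $s<_{\mathcal{A}}t$ if the SCC of $t$ is reachable from that of $s$ and they are different. $p$ = lcm of lengths of all simple cycles of $\mathcal{A}$. A positional word is a word over $(\mathbb{Z}/p\mathbb{Z})\times\Sigma$ of the form $(n\bmod p,a_0)((n+1)\bmod p,a_1)\cdots$, written $\langle n:u\rangle$. A portal is $P=(s,x,t,y)\in(Q\times\mathbb{Z}/p\mathbb{Z})^2$ with $s,t$ in the same SCC; $L(P)=\{\langle x:w\rangle: s\xrightarrow{w}t,\ x+|w|\equiv y\pmod p\}$; a positional word is blocking for $P$ if it is not a factor of any word of $L(P)$. An SCC-path is $\pi=P_0\xrightarrow{a_1}\cdots\xrightarrow{a_k}P_k$ with portals $P_i=(s_i,x_i,t_i,y_i)$, $x_i\equiv y_{i-1}+1$, $s_i\in\delta(t_{i-1},a_i)$, $t_{i-1}<_{\mathcal{A}}s_i$; $L(\pi)=L(P_0)(y_0,a_1)L(P_1)\cdots(y_{k-1},a_k)L(P_k)$. A finite sequence $\sigma=(\nu_1,\dots,\nu_\ell)$ of positional words is strongly blocking for $\pi$ if there are indices $i_0<i_1<\cdots<i_k$ such that $\nu_{i_j}$ is blocking for $P_j$ for each $j$. The word $\mu$ contains $\sigma$ if $\mu=\alpha_0\nu_1\alpha_1\nu_2\cdots\nu_\ell\alpha_\ell$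 for some positional words $\alpha_i$ (occurrences in order, non-overlapping). -}

module Defs where

open import Data.Nat using (ℕ; zero; suc; _+_; NonZero)
open import Data.Nat.Divisibility using (_∣_)
open import Data.Nat.DivMod using (_mod_)
open import Data.Fin using (Fin; toℕ; inject₁; fromℕ; _<_)
open import Data.Fin.Subset using (Subset; _∈_)
open import Data.List using (List; []; _∷_; _++_; length)
open import Data.List.Relation.Unary.All using (All)
open import Data.Product using (Σ; ∃; _×_; _,_)
open import Relation.Nullary using (¬_)
open import Relation.Binary.PropositionalEquality using (_≡_)
open import Function.Definitions using (Injective)

record NFA (n m : ℕ) : Set where
  field
    δ  : Fin n → Fin m → Subset n
    q₀ : Fin n
    F  : Subset n

module _ {n m : ℕ} (A : NFA n m) where
  open NFA A

  data Run : Fin n → List (Fin m) → Fin n → Set where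
    run[] : ∀ {s} → Run s [] s
    run∷  : ∀ {s a w s' t} → s' ∈ δ s a → Run s' w t → Run s (a ∷ w) t

  Reach : Fin n → Fin n → Set
  Reach s t = ∃ λ w → Run s w t

  SameSCC : Fin n → Fin n → Set
  SameSCC s t = Reach s t × Reach t s

  _<A_ : Fin n → Fin n → Set
  s <A t = Reach s t × ¬ SameSCC s t

  HasSimpleCycleOfLength : ℕ → Set
  HasSimpleCycleOfLength zero = Data.Empty.⊥
    where import Data.Empty
  HasSimpleCycleOfLength (suc k) =
    Σ (Fin (suc k) → Fin n) λ c →
      Injective _≡_ _≡_ c ×
      ((i : Fin k) → ∃ λ a → c (Fin.suc i) ∈ δ (c (inject₁ i)) a) ×
      (∃ λ a → c Fin.zero ∈ δ (c (fromℕ k)) a)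

  IsCycleLcm : ℕ → Set
  IsCycleLcm p =
    ((k : ℕ) → HasSimpleCycleOfLength k → k ∣ p) ×
    ((q : ℕ) → ((k : ℕ) → HasSimpleCycleOfLength k → k ∣ q) → p ∣ q)

  module Positional (p : ℕ) .{{_ : NonZero p}} where

    Letter : Set
    Letter = Fin p × Fin m

    Word : Set
    Word = List Letter

    sucmod : Fin p → Fin p
    sucmod x = suc (toℕ x) mod p

    ⟨_∶_⟩ : Fin p → List (Fin m) → Word
    ⟨ x ∶ [] ⟩ = []
    ⟨ x ∶ a ∷ u ⟩ = (x , a) ∷ ⟨ sucmod x ∶ u ⟩

    IsPositional : Word → Set
    IsPositional μ = ∃ λ x → ∃ λ u → μ ≡ ⟨ x ∶ u ⟩

    Factor : Word → Word → Set
    Factor ν w = ∃ λ u → ∃ λ v → w ≡ u ++ (ν ++ v)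

    record Portal : Set where
      constructor portal
      field
        s : Fin n
        x : Fin p
        t : Fin n
        y : Fin p
        sameSCC : SameSCC s t

    InPortal : Portal → Word → Set
    InPortal P μ = ∃ λ w →
      Run (Portal.s P) w (Portal.t P) ×
      ((toℕ (Portal.x P) + length w) mod p ≡ Portal.y P) ×
      μ ≡ ⟨ Portal.x P ∶ w ⟩

    Blocking : Word → Portal → Set
    Blocking ν P = ¬ (∃ λ w → InPortal P w × Factor ν w)

    -- SCC-path P₀ --a₁--> P₁ ... --a_k--> P_k ; letter i : Fin k is a_{i+1}
    record SCCPath : Set where
      field
        k       : ℕ
        P       : Fin (suc k) → Portal
        a       : Fin k → Fin m
        posOK   : (i : Fin k) → Portal.x (P (Fin.suc i)) ≡ sucmod (Portal.y (P (inject₁ i)))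
        transOK : (i : Fin k) → Portal.s (P (Fin.suc i)) ∈ δ (Portal.t (P (inject₁ i))) (a i)
        orderOK : (i : Fin k) → Portal.t (P (inject₁ i)) <A Portal.s (P (Fin.suc i))

    interleave : (k : ℕ) → (Fin (suc k) → Word) → (Fin k → Letter) → Word
    interleave zero ws ls = ws Fin.zero
    interleave (suc k) ws ls =
      ws Fin.zero ++ (ls Fin.zero ∷ interleave k (λ i → ws (Fin.suc i)) (λ i → ls (Fin.suc i)))

    InPath : SCCPath → Word → Set
    InPath π μ = ∃ λ (ws : Fin (suc k) → Word) →
      ((j : Fin (suc k)) → InPortal (P j) (ws j)) ×
      μ ≡ interleave k ws (λ i → (Portal.y (P (inject₁ i)) , a i))
      where open SCCPath π

    lookupL : (σ : List Word) → Fin (length σ) → Word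
    lookupL (ν ∷ σ) Fin.zero = ν
    lookupL (ν ∷ σ) (Fin.suc i) = lookupL σ i

    StronglyBlocking : List Word → SCCPath → Set
    StronglyBlocking σ π =
      Σ (Fin (suc k) → Fin (length σ)) λ idx →
        ((i : Fin k) → idx (inject₁ i) < idx (Fin.suc i)) ×
        ((j : Fin (suc k)) → Blocking (lookupL σ (idx j)) (P j))
      where open SCCPath π

    Contains : Word → List Word → Set
    Contains μ [] = IsPositional μ
    Contains μ (ν ∷ σ) = ∃ λ α → ∃ λ μ' →
      IsPositional α × μ ≡ α ++ (ν ++ μ') × Contains μ' σ

{-# OPTIONS --safe #-}
module Submission where

-- Write μ = w₀ (y₀,a₁) w₁ ⋯ (y_{k-1},a_k) w_k with wⱼ ∈ L(Pⱼ), and scan the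
-- occurrences ν₁, ν₂, … of σ in μ from left to right.  The blocker for P₀ is
-- not a factor of w₀, so its occurrence reaches past w₀ at least into the
-- separator letter, and all later occurrences lie in w₁ (y₁,a₂) ⋯ w_k; the
-- same argument then applies to w₁, …, w_{k-1}.  At w_k no separator is left,
-- so the blocker for P_k would have to occur inside w_k.

open import Defs
open import Data.Nat using (ℕ; NonZero)
open import Data.List using (List)
open import Data.List.Relation.Unary.All using (All)
open import Relation.Nullary using (¬_)

open import Data.Nat.Base as ℕ using (s<s⁻¹)
open import Data.Nat.Properties using (m<n⇒0<n)
open import Data.Fin.Base using (Fin; zero; suc; toℕ; inject₁; _<_)
open import Data.List.Base using ([]; _∷_; _++_; length; lookup; tabulate)
open import Data.List.Properties using (∷-injectiveˡ; ∷-injectiveʳ; ++-assoc)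
open import Data.List.Relation.Binary.Sublist.Heterogeneous using (Sublist; _∷_; _∷ʳ_; minimum)
open import Data.Product using (∃; ∃₂; _×_; _,_)
open import Data.Unit.Polymorphic using (⊤; tt)
open import Function using (_∘_)
open import Level using (_⊔_)
open import Relation.Binary.Core using (REL)
open import Relation.Binary.PropositionalEquality using (_≡_; refl; sym; trans; cong; subst)
open import Relation.Nullary using (contradiction)

module _ {a} {L : Set a} where

  ¬prefix⇒suffix : ∀ (w : List L) {l r} β μ′ → w ++ l ∷ r ≡ β ++ μ′ →
    ¬ (∃ λ v → w ≡ β ++ v) → ∃ λ γ → r ≡ γ ++ μ′
  ¬prefix⇒suffix []      []      μ′ eq ¬pre = contradiction ([] , refl) ¬pre
  ¬prefix⇒suffix []      (b ∷ β) μ′ eq ¬pre = β , ∷-injectiveʳ eq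
  ¬prefix⇒suffix (c ∷ w) []      μ′ eq ¬pre = contradiction (c ∷ w , refl) ¬pre
  ¬prefix⇒suffix (c ∷ w) (b ∷ β) μ′ eq ¬pre =
    ¬prefix⇒suffix w β μ′ (∷-injectiveʳ eq) λ (v , w≡βv) →
      ¬pre (v , subst (λ x → c ∷ w ≡ x ∷ β ++ v) (∷-injectiveˡ eq) (cong (c ∷_) w≡βv))

  -- Contains with the gaps α no longer required to be positional, which makes
  -- it stable under prepending (a concatenation of positional words need not be one).
  InOrderIn : List (List L) → List L → Set a
  InOrderIn []      μ = ⊤
  InOrderIn (ν ∷ σ) μ = ∃₂ λ α μ′ → μ ≡ α ++ ν ++ μ′ × InOrderIn σ μ′

  inOrderIn-++ˡ : ∀ {σ} γ {μ} → InOrderIn σ μ → InOrderIn σ (γ ++ μ)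
  inOrderIn-++ˡ {[]}    γ tt                   = tt
  inOrderIn-++ˡ {ν ∷ σ} γ (α , μ′ , refl , occ) = γ ++ α , μ′ , sym (++-assoc γ α (ν ++ μ′)) , occ

  inOrderIn-tail : ∀ {ν σ μ} → InOrderIn (ν ∷ σ) μ → InOrderIn σ μ
  inOrderIn-tail {ν} (α , μ′ , refl , occ) = inOrderIn-++ˡ α (inOrderIn-++ˡ ν occ)

  inOrderIn-beyond : ∀ w {l r ν σ} → ¬ (∃₂ λ u v → w ≡ u ++ ν ++ v) →
    InOrderIn (ν ∷ σ) (w ++ l ∷ r) → InOrderIn σ r
  inOrderIn-beyond w {ν = ν} ¬ν⊑w (α , μ′ , eq , occ) with
    ¬prefix⇒suffix w (α ++ ν) μ′ (trans eq (sym (++-assoc α ν μ′)))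
      (λ (v , w≡) → ¬ν⊑w (α , v , trans w≡ (++-assoc α ν v)))
  ... | γ , r≡ = subst (InOrderIn _) (sym r≡) (inOrderIn-++ˡ γ occ)

predᶠ : ∀ {n} (i : Fin (ℕ.suc n)) → 0 ℕ.< toℕ i → Fin n
predᶠ (suc i) _ = i

predᶠ-mono-< : ∀ {n} {i j : Fin (ℕ.suc n)} (i>0 : 0 ℕ.< toℕ i) (j>0 : 0 ℕ.< toℕ j) →
  i < j → predᶠ i i>0 < predᶠ j j>0
predᶠ-mono-< {i = suc _} {suc _} _ _ = s<s⁻¹

lookup-predᶠ : ∀ {a} {B : Set a} {y : B} ys (i : Fin (ℕ.suc (length ys))) (i>0 : 0 ℕ.< toℕ i) →
  lookup (y ∷ ys) i ≡ lookup ys (predᶠ i i>0)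
lookup-predᶠ ys (suc i) _ = refl

module _ {a b r} {A : Set a} {B : Set b} (R : REL A B r) where

  record IncreasingMatch {k} (xs : Fin (ℕ.suc k) → A) (ys : List B) : Set (a ⊔ b ⊔ r) where
    constructor increasingMatch
    field
      index      : Fin (ℕ.suc k) → Fin (length ys)
      increasing : ∀ i → index (inject₁ i) < index (suc i)
      related    : ∀ j → R (xs j) (lookup ys (index j))

module _ {a b r} {A : Set a} {B : Set b} {R : REL A B r} where

  open IncreasingMatch

  pop : ∀ {k} {xs : Fin (ℕ.suc k) → A} {y ys} (m : IncreasingMatch R xs (y ∷ ys)) →
    (∀ j → 0 ℕ.< toℕ (index m j)) → IncreasingMatch R xs ys
  pop (increasingMatch f f↑ xRf) f>0 = increasingMatch
    (λ j → predᶠ (f j) (f>0 j))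
    (λ i → predᶠ-mono-< (f>0 _) (f>0 _) (f↑ i))
    (λ j → subst (R _) (lookup-predᶠ _ (f j) (f>0 j)) (xRf j))

  increasingMatch⇒sublist : ∀ {k} {xs : Fin (ℕ.suc k) → A} {ys} →
    IncreasingMatch R xs ys → Sublist R (tabulate xs) ys
  increasingMatch⇒sublist {ys = []}     m with () ← index m zero
  increasingMatch⇒sublist {ys = y ∷ ys} m with index m zero in f₀≡
  ... | zero  = subst (R _) (cong (lookup _) f₀≡) (related m zero) ∷ tail m
    where
    tail : ∀ {k} {xs : Fin (ℕ.suc k) → A} → IncreasingMatch R xs (y ∷ ys) →
      Sublist R (tabulate (xs ∘ suc)) ys
    tail {ℕ.zero}  _ = minimum ys
    tail {ℕ.suc _} (increasingMatch f f↑ xRf) = increasingMatch⇒sublist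
      (pop (increasingMatch (f ∘ suc) (f↑ ∘ suc) (xRf ∘ suc)) (m<n⇒0<n ∘ f↑))
  ... | suc _ = y ∷ʳ increasingMatch⇒sublist (pop m f>0)
    where
    f>0 : ∀ j → 0 ℕ.< toℕ (index m j)
    f>0 zero    = subst (λ i → 0 ℕ.< toℕ i) (sym f₀≡) ℕ.z<s
    f>0 (suc i) = m<n⇒0<n (increasing m i)

module _ {n m : ℕ} (A : NFA n m) (p : ℕ) .{{_ : NonZero p}} where
  open Positional A p

  lookupL≡lookup : ∀ σ i → lookupL σ i ≡ lookup σ i
  lookupL≡lookup (ν ∷ σ) zero    = refl
  lookupL≡lookup (ν ∷ σ) (suc i) = lookupL≡lookup σ i

  contains⇒inOrderIn : ∀ {μ} σ → Contains μ σ → InOrderIn σ μ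
  contains⇒inOrderIn []      _                     = tt
  contains⇒inOrderIn (ν ∷ σ) (α , μ′ , _ , eq , c) = α , μ′ , eq , contains⇒inOrderIn σ c

  interleave-¬inOrderIn : ∀ k (ws : Fin (ℕ.suc k) → Word) (ls : Fin k → Letter) {σ} →
    Sublist (λ w ν → ¬ Factor ν w) (tabulate ws) σ → ¬ InOrderIn σ (interleave k ws ls)
  interleave-¬inOrderIn k         ws ls (_ ∷ʳ blocks) occ =
    interleave-¬inOrderIn k ws ls blocks (inOrderIn-tail occ)
  interleave-¬inOrderIn ℕ.zero    ws ls (¬ν⊑w ∷ _) (α , μ′ , eq , _) = ¬ν⊑w (α , μ′ , eq)
  interleave-¬inOrderIn (ℕ.suc k) ws ls (¬ν⊑w ∷ blocks) occ =
    interleave-¬inOrderIn k (ws ∘ suc) (ls ∘ suc) blocks (inOrderIn-beyond (ws zero) ¬ν⊑w occ)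

lemma44 : {n m : ℕ} (A : NFA n m) (p : ℕ) .{{_ : NonZero p}} →
    IsCycleLcm A p →
    let open Positional A p in
    (π : SCCPath) (μ : Word) → IsPositional μ →
    (σ : List Word) → All IsPositional σ →
    Contains μ σ → StronglyBlocking σ π → ¬ InPath π μ
lemma44 A p _ π _ _ σ _ μ⊒σ (idx , idx↑ , blocking) (ws , ws∈P , μ≡) =
  interleave-¬inOrderIn A p k ws _ (increasingMatch⇒sublist (increasingMatch idx idx↑ blocks))
    (subst (InOrderIn σ) μ≡ (contains⇒inOrderIn A p σ μ⊒σ))
  where
  open Positional A p
  open SCCPath π
  blocks : ∀ j → ¬ Factor (lookup σ (idx j)) (ws j)
  blocks j ν⊑w = blocking j (ws j , ws∈P j ,
    subst (λ ν → Factor ν (ws j)) (sym (lookupL≡lookup A p σ (idx j))) ν⊑w)
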